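{- Let $n$ be a non-negative integer and let $r$ be a positive integer. Let $P(n,r)$ denote the number of lattice paths in the plane using unit steps $(1,0)$ and $(0,1)$ from $(0,0)$ to $(n+r,\,n+r-1)$ that never touch any point of the set $\{(x,x)\in\mathbb{Z}^2 : x\ge r\}$. Then \[ P(n,r)=\sum_{k=0}^{r-1}\binom{2k}{k}\,C_{n+r-k-1}, \] where $C_m=\frac{1}{m+1}\binom{2m}{m}$ is the $m$th Catalan number.
   Context: $P(n,r)$ is called the Gessel number. $C_m=\frac{1}{m+1}\binom{2m}{m}$ denotes the $m$th Catalan number. -}

module Defs where

open import Data.Nat using (ℕ; zero; suc; _+_; _*_; _∸_; _≤_; _≡ᵇ_; _≤ᵇ_)
open import Data.Nat.Combinatorics using (_C_)
open import Data.Nat.DivMod using (_/_)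
open import Data.Bool using (Bool; true; false; _∧_; _∨_; not)
open import Data.Bool.Properties using () renaming (_≟_ to _≟ᵇ_)
open import Data.List using (List; []; _∷_; _++_; map; length; filter; sum)
open import Data.Product using (_×_; _,_)

-- A unit step: true = (1,0) (east), false = (0,1) (north).
Step : Set
Step = Bool

Path : Set
Path = List Step

allPaths : ℕ → List Path
allPaths zero = [] ∷ []
allPaths (suc L) = map (true ∷_) (allPaths L) ++ map (false ∷_) (allPaths L)

move : Step → ℕ × ℕ → ℕ × ℕ
move true  (x , y) = (suc x , y)
move false (x , y) = (x , suc y)

forbidden : ℕ → ℕ × ℕ → Bool
forbidden r (x , y) = (x ≡ᵇ y) ∧ (r ≤ᵇ x)

touchesFrom : ℕ → ℕ × ℕ → Path → Bool
touchesFrom r p [] = forbidden r p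
touchesFrom r p (s ∷ ss) = forbidden r p ∨ touchesFrom r (move s p) ss

endFrom : ℕ × ℕ → Path → ℕ × ℕ
endFrom p [] = p
endFrom p (s ∷ ss) = endFrom (move s p) ss

endsAt : ℕ → ℕ → Path → Bool
endsAt a b π with endFrom (0 , 0) π
... | (x , y) = (x ≡ᵇ a) ∧ (y ≡ᵇ b)

-- Admissible paths for P(n,r): from (0,0) to (n+r, n+r-1), never touching
-- {(x,x) : x ≥ r}. Any such path has exactly 2(n+r)-1 steps.
good : ℕ → ℕ → Path → Bool
good n r π = endsAt (n + r) (n + r ∸ 1) π ∧ not (touchesFrom r (0 , 0) π)

P : ℕ → ℕ → ℕ
P n r = length (filter (λ π → good n r π ≟ᵇ true)
                       (allPaths ((n + r) + (n + r ∸ 1))))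

catalan : ℕ → ℕ
catalan m = ((2 * m) C m) / suc m

sumBelow : ℕ → (ℕ → ℕ) → ℕ
sumBelow zero f = 0
sumBelow (suc r) f = sumBelow r f + f r

{-# OPTIONS --safe #-}
module Submission where

open import Defs
open import Data.Bool using (Bool; true; false; if_then_else_; _∧_; _∨_; not)
open import Data.Bool.Properties using (∧-zeroʳ) renaming (_≟_ to _≟ᵇ_)
open import Data.List using (List; []; _∷_; _++_; map; length; filter)
open import Data.List.Properties using (length-++; filter-++; filter-≐; filter-none; filter-accept)
open import Data.List.Relation.Unary.All using (universal)
open import Data.Nat using (ℕ; zero; suc; _+_; _*_; _∸_; _≤_; _<_; s≤s; z≤n)
open import Data.Nat.Combinatorics using (_C_; nCn≡1; nCk+nC[k+1]≡[n+1]C[k+1])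
open import Data.Nat.DivMod using (_/_; m*n/n≡m)
open import Data.Nat.Properties
open import Algebra.Properties.CommutativeSemigroup +-commutativeSemigroup using (interchange; x∙yz≈y∙xz)
open import Data.Nat.Tactic.RingSolver using (solve-∀)
open import Data.Product using (_×_; _,_; proj₁; proj₂)
open import Data.Sum using (_⊎_; inj₁; inj₂)
open import Function using (case_of_)
open import Function.Bundles using (mk⇔)
open import Relation.Binary.PropositionalEquality
open import Relation.Nullary using (¬_; yes; no; does; _×-dec_; contradiction)
open import Relation.Nullary.Decidable using (dec-true; dec-false; does-⇔)

-- Read backwards from its endpoint, with coordinates measured from (n + r, n + r - 1), an
-- admissible path becomes a monotone path from (0, 0) to (n + r, n + r - 1) avoiding the points
-- (j + 1, j) with j < n.  Such a path ends below the diagonal, so it has a first step below it,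
-- from (j, j) to (j + 1, j) with n ≤ j < n + r.  Up to that step it is a ballot path, and there
-- are C_j of those (reflection principle); after it, it is a free path, and there are
-- binom(2k, k) of those with k = n + r - 1 - j.  This first-step decomposition holds because
-- both sides satisfy the same lattice-path recurrence.

-- Weighted lattice paths

Grid : Set
Grid = ℕ → ℕ → ℕ

Region : Set
Region = ℕ → ℕ → Bool

left below : Grid → Grid
left f zero    v = 0
left f (suc u) v = f u v
below f u zero    = 0
below f u (suc v) = f u v

left-+ : ∀ {f g} u v → left (λ x y → f x y + g x y) u v ≡ left f u v + left g u v
left-+ zero    v = refl
left-+ (suc u) v = refl

below-+ : ∀ {f g} u v → below (λ x y → f x y + g x y) u v ≡ below f u v + below g u v
below-+ u zero    = refl
below-+ u (suc v) = refl

left-* : ∀ c {f} u v → left (λ x y → c * f x y) u v ≡ c * left f u v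
left-* c zero    v = sym (*-zeroʳ c)
left-* c (suc u) v = refl

below-* : ∀ c {f} u v → below (λ x y → c * f x y) u v ≡ c * below f u v
below-* c u zero    = sym (*-zeroʳ c)
below-* c u (suc v) = refl

step : Region → Grid → Grid → Grid
step b s f u v = if b u v then 0 else s u v + left f u v + below f u v

-- walks b s u v counts the monotone lattice paths ending at (u, v) that avoid
-- the region b, a path starting at (x, y) being counted with weight s x y.
walks : Region → Grid → Grid
walks b s zero    zero    = if b 0 0 then 0 else s 0 0 + 0 + 0
walks b s (suc u) zero    = if b (suc u) 0 then 0 else s (suc u) 0 + walks b s u 0 + 0
walks b s zero    (suc v) = if b 0 (suc v) then 0 else s 0 (suc v) + 0 + walks b s 0 v
walks b s (suc u) (suc v) =
  if b (suc u) (suc v) then 0 else s (suc u) (suc v) + walks b s u (suc v) + walks b s (suc u) v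

module _ {b : Region} where

  walks-step : ∀ {s} u v → walks b s u v ≡ step b s (walks b s) u v
  walks-step zero    zero    = refl
  walks-step (suc u) zero    = refl
  walks-step zero    (suc v) = refl
  walks-step (suc u) (suc v) = refl

  step-blocked : ∀ {s f u v} → b u v ≡ true → step b s f u v ≡ 0
  step-blocked e = cong (if_then 0 else _) e

  step-open : ∀ {s f u v} → b u v ≡ false → step b s f u v ≡ s u v + left f u v + below f u v
  step-open e = cong (if_then 0 else _) e

  step-cong : ∀ {s f g u v} → left f u v ≡ left g u v → below f u v ≡ below g u v →
              step b s f u v ≡ step b s g u v
  step-cong {s} {u = u} {v} = cong₂ (λ l d → if b u v then 0 else s u v + l + d)

  walks-unique : ∀ {s f} U V → (∀ u v → u ≤ U → v ≤ V → f u v ≡ step b s f u v) →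
                 ∀ u v → u ≤ U → v ≤ V → f u v ≡ walks b s u v
  walks-unique {s} {f} U V rec u v u≤U v≤V = begin
    f u v                    ≡⟨ rec u v u≤U v≤V ⟩
    step b s f u v           ≡⟨ step-cong {s} (onLeft u v u≤U v≤V) (onBelow u v u≤U v≤V) ⟩
    step b s (walks b s) u v ≡⟨ walks-step u v ⟨
    walks b s u v            ∎
    where
    open ≡-Reasoning
    onLeft : ∀ u v → u ≤ U → v ≤ V → left f u v ≡ left (walks b s) u v
    onLeft zero    v _   _   = refl
    onLeft (suc u) v u<U v≤V = walks-unique U V rec u v (<⇒≤ u<U) v≤V
    onBelow : ∀ u v → u ≤ U → v ≤ V → below f u v ≡ below (walks b s) u v
    onBelow u zero    _   _   = refl
    onBelow u (suc v) u≤U v<V = walks-unique U V rec u v u≤U (<⇒≤ v<V)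

  walks-blocked : ∀ {s u v} → b u v ≡ true → walks b s u v ≡ 0
  walks-blocked {s} {u} {v} e = trans (walks-step u v) (step-blocked {s} {walks b s} e)

  walks-open : ∀ {s u v} → b u v ≡ false →
               walks b s u v ≡ s u v + left (walks b s) u v + below (walks b s) u v
  walks-open {s} {u} {v} e = trans (walks-step u v) (step-open {s} {walks b s} e)

  step-zero : ∀ {s f u v} → s u v ≡ 0 → left f u v ≡ 0 → below f u v ≡ 0 → step b s f u v ≡ 0
  step-zero {u = u} {v} hs hl hb with b u v
  ... | true  = refl
  ... | false = cong₂ _+_ (cong₂ _+_ hs hl) hb

  walks-vanish : ∀ {s} u v → (∀ x y → x ≤ u → y ≤ v → s x y ≡ 0) → walks b s u v ≡ 0
  walks-vanish {s} u v zeroOnBox =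
    trans (walks-step u v)
          (step-zero {s} {walks b s} (zeroOnBox u v ≤-refl ≤-refl) (onLeft u zeroOnBox) (onBelow v zeroOnBox))
    where
    onLeft : ∀ u → (∀ x y → x ≤ u → y ≤ v → s x y ≡ 0) → left (walks b s) u v ≡ 0
    onLeft zero    _ = refl
    onLeft (suc u) h = walks-vanish u v (λ x y x≤u y≤v → h x y (m≤n⇒m≤1+n x≤u) y≤v)
    onBelow : ∀ v → (∀ x y → x ≤ u → y ≤ v → s x y ≡ 0) → below (walks b s) u v ≡ 0
    onBelow zero    _ = refl
    onBelow (suc v) h = walks-vanish u v (λ x y x≤u y≤v → h x y x≤u (m≤n⇒m≤1+n y≤v))

  step-+ : ∀ {s t f g} u v →
           step b s f u v + step b t g u v ≡ step b (λ x y → s x y + t x y) (λ x y → f x y + g x y) u v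
  step-+ {s} {t} {f} {g} u v with b u v
  ... | true  = refl
  ... | false = begin
    (s u v + left f u v + below f u v) + (t u v + left g u v + below g u v)
      ≡⟨ interchange (s u v + left f u v) (below f u v) (t u v + left g u v) (below g u v) ⟩
    ((s u v + left f u v) + (t u v + left g u v)) + (below f u v + below g u v)
      ≡⟨ cong₂ _+_ (interchange (s u v) (left f u v) (t u v) (left g u v)) (sym (below-+ u v)) ⟩
    (s u v + t u v) + (left f u v + left g u v) + below (λ x y → f x y + g x y) u v
      ≡⟨ cong (λ l → (s u v + t u v) + l + below (λ x y → f x y + g x y) u v) (left-+ u v) ⟨
    (s u v + t u v) + left (λ x y → f x y + g x y) u v + below (λ x y → f x y + g x y) u v ∎
    where open ≡-Reasoning

  step-* : ∀ c {s f} u v → c * step b s f u v ≡ step b (λ x y → c * s x y) (λ x y → c * f x y) u v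
  step-* c {s} {f} u v with b u v
  ... | true  = *-zeroʳ c
  ... | false = begin
    c * (s u v + left f u v + below f u v)
      ≡⟨ *-distribˡ-+ c (s u v + left f u v) (below f u v) ⟩
    c * (s u v + left f u v) + c * below f u v
      ≡⟨ cong₂ _+_ (*-distribˡ-+ c (s u v) (left f u v)) (sym (below-* c u v)) ⟩
    c * s u v + c * left f u v + below (λ x y → c * f x y) u v
      ≡⟨ cong (λ l → c * s u v + l + below (λ x y → c * f x y) u v) (left-* c u v) ⟨
    c * s u v + left (λ x y → c * f x y) u v + below (λ x y → c * f x y) u v ∎
    where open ≡-Reasoning

  walks-+ : ∀ {s t} u v → walks b (λ x y → s x y + t x y) u v ≡ walks b s u v + walks b t u v
  walks-+ {s} {t} u v = sym (walks-unique u v satisfies u v ≤-refl ≤-refl)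
    where
    satisfies : ∀ x y → x ≤ u → y ≤ v → walks b s x y + walks b t x y ≡
                step b (λ x y → s x y + t x y) (λ x y → walks b s x y + walks b t x y) x y
    satisfies x y _ _ = trans (cong₂ _+_ (walks-step x y) (walks-step x y)) (step-+ {s} {t} x y)

  walks-* : ∀ c {s} u v → walks b (λ x y → c * s x y) u v ≡ c * walks b s u v
  walks-* c {s} u v = sym (walks-unique u v satisfies u v ≤-refl ≤-refl)
    where
    satisfies : ∀ x y → x ≤ u → y ≤ v → c * walks b s x y ≡
                step b (λ x y → c * s x y) (λ x y → c * walks b s x y) x y
    satisfies x y _ _ = trans (cong (c *_) (walks-step x y)) (step-* c {s} x y)

  walks-sum : ∀ m (c : ℕ → ℕ) (t : ℕ → Grid) u v →
              walks b (λ x y → sumBelow m (λ i → c i * t i x y)) u v ≡ sumBelow m (λ i → c i * walks b (t i) u v)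
  walks-sum zero    c t u v = walks-vanish u v (λ _ _ _ _ → refl)
  walks-sum (suc m) c t u v = begin
    walks b (λ x y → sumBelow m (λ i → c i * t i x y) + c m * t m x y) u v
      ≡⟨ walks-+ {λ x y → sumBelow m (λ i → c i * t i x y)} u v ⟩
    walks b (λ x y → sumBelow m (λ i → c i * t i x y)) u v + walks b (λ x y → c m * t m x y) u v
      ≡⟨ cong₂ _+_ (walks-sum m c t u v) (walks-* (c m) {t m} u v) ⟩
    sumBelow m (λ i → c i * walks b (t i) u v) + c m * walks b (t m) u v ∎
    where open ≡-Reasoning

point : ℕ → ℕ → Grid
point x y u v = if does (u ≟ x ×-dec v ≟ y) then 1 else 0

origin : Grid
origin = point 0 0

point-at : ∀ x y → point x y x y ≡ 1
point-at x y = cong (if_then 1 else 0) (dec-true (x ≟ x ×-dec y ≟ y) (refl , refl))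

point-elsewhere : ∀ {x y u v} → ¬ (u ≡ x × v ≡ y) → point x y u v ≡ 0
point-elsewhere {x} {y} {u} {v} ne = cong (if_then 1 else 0) (dec-false (u ≟ x ×-dec v ≟ y) ne)

walks-point-outside : ∀ {b x y u v} → u < x ⊎ v < y → walks b (point x y) u v ≡ 0
walks-point-outside {x = x} {y} {u} {v} outside = walks-vanish u v zeroOnBox
  where
  zeroOnBox : ∀ u′ v′ → u′ ≤ u → v′ ≤ v → point x y u′ v′ ≡ 0
  zeroOnBox u′ v′ u′≤u v′≤v =
    point-elsewhere {x} {y} {u′} {v′} λ { (refl , refl) → insideBox u′≤u v′≤v outside }
    where
    insideBox : x ≤ u → y ≤ v → ¬ (u < x ⊎ v < y)
    insideBox x≤u _ (inj₁ u<x) = <⇒≱ u<x x≤u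
    insideBox _ y≤v (inj₂ v<y) = <⇒≱ v<y y≤v

sumBelow-cong : ∀ m {f g : ℕ → ℕ} → (∀ {i} → i < m → f i ≡ g i) → sumBelow m f ≡ sumBelow m g
sumBelow-cong zero    eq = refl
sumBelow-cong (suc m) eq = cong₂ _+_ (sumBelow-cong m (λ i<m → eq (m<n⇒m<1+n i<m))) (eq ≤-refl)

sumBelow-zero : ∀ m {f : ℕ → ℕ} → (∀ {i} → i < m → f i ≡ 0) → sumBelow m f ≡ 0
sumBelow-zero zero    eq = refl
sumBelow-zero (suc m) eq = cong₂ _+_ (sumBelow-zero m (λ i<m → eq (m<n⇒m<1+n i<m))) (eq ≤-refl)

sumBelow-single : ∀ {m i} {f : ℕ → ℕ} → i < m → (∀ {j} → j ≢ i → f j ≡ 0) → sumBelow m f ≡ f i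
sumBelow-single {suc m} {i} {f} i<1+m others with m≤n⇒m<n∨m≡n (≤-pred i<1+m)
... | inj₁ i<m  = trans (cong₂ _+_ (sumBelow-single i<m others) (others (>⇒≢ i<m))) (+-identityʳ (f i))
... | inj₂ refl = cong (_+ f i) (sumBelow-zero i (λ j<i → others (<⇒≢ j<i)))

sumBelow-unshift : ∀ m (f : ℕ → ℕ) → sumBelow (suc m) f ≡ f 0 + sumBelow m (λ k → f (suc k))
sumBelow-unshift zero    f = +-comm 0 (f 0)
sumBelow-unshift (suc m) f = trans (cong (_+ f (suc m)) (sumBelow-unshift m f)) (+-assoc (f 0) _ _)

sumBelow-reverse : ∀ m (f : ℕ → ℕ) → sumBelow m f ≡ sumBelow m (λ k → f (m ∸ suc k))
sumBelow-reverse zero    f = refl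
sumBelow-reverse (suc m) f = begin
  sumBelow m f + f m                            ≡⟨ cong (_+ f m) (sumBelow-reverse m f) ⟩
  sumBelow m (λ k → f (m ∸ suc k)) + f m        ≡⟨ +-comm _ (f m) ⟩
  f m + sumBelow m (λ k → f (m ∸ suc k))        ≡⟨ sumBelow-unshift m (λ k → f (m ∸ k)) ⟨
  sumBelow (suc m) (λ k → f (suc m ∸ suc k))    ∎
  where open ≡-Reasoning

-- Free paths and binomial coefficients

nowhere : Region
nowhere _ _ = false

paths : Grid
paths = walks nowhere origin

paths-zeroˡ : ∀ v → paths 0 v ≡ 1
paths-zeroˡ zero    = refl
paths-zeroˡ (suc v) = paths-zeroˡ v

paths-zeroʳ : ∀ u → paths u 0 ≡ 1
paths-zeroʳ zero    = refl
paths-zeroʳ (suc u) = trans (+-identityʳ _) (paths-zeroʳ u)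

paths-sym : ∀ u v → paths u v ≡ paths v u
paths-sym zero    v       = trans (paths-zeroˡ v) (sym (paths-zeroʳ v))
paths-sym (suc u) zero    = trans (paths-zeroʳ (suc u)) (sym (paths-zeroˡ (suc u)))
paths-sym (suc u) (suc v) =
  trans (cong₂ _+_ (paths-sym u (suc v)) (paths-sym (suc u) v)) (+-comm (paths (suc v) u) _)

paths≡binomial : ∀ u v → paths u v ≡ (u + v) C u
paths≡binomial zero    v       = paths-zeroˡ v
paths≡binomial (suc u) zero    = begin
  paths (suc u) 0         ≡⟨ paths-zeroʳ (suc u) ⟩
  1                       ≡⟨ nCn≡1 (suc u) ⟨
  suc u C suc u           ≡⟨ cong (_C suc u) (+-identityʳ (suc u)) ⟨
  (suc u + 0) C suc u     ∎
  where open ≡-Reasoning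
paths≡binomial (suc u) (suc v) = begin
  paths u (suc v) + paths (suc u) v           ≡⟨ cong₂ _+_ (paths≡binomial u (suc v)) (paths≡binomial (suc u) v) ⟩
  (u + suc v) C u + suc (u + v) C suc u       ≡⟨ cong (λ m → (u + suc v) C u + m C suc u) (+-suc u v) ⟨
  (u + suc v) C u + (u + suc v) C suc u       ≡⟨ nCk+nC[k+1]≡[n+1]C[k+1] (u + suc v) u ⟩
  suc (u + suc v) C suc u                     ∎
  where open ≡-Reasoning

paths-sucʳ : ∀ u v → paths u (suc v) ≡ left paths u (suc v) + paths u v
paths-sucʳ zero    v = refl
paths-sucʳ (suc u) v = refl

paths-absorbˡ : ∀ a b → suc a * paths (suc a) b ≡ suc (a + b) * paths a b
paths-absorbʳ : ∀ a b → suc b * paths a (suc b) ≡ suc (a + b) * paths a b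

paths-absorbˡ a zero = begin
  suc a * paths (suc a) 0    ≡⟨ cong (suc a *_) (paths-zeroʳ (suc a)) ⟩
  suc a * 1                  ≡⟨ cong₂ _*_ (cong suc (+-identityʳ a)) (paths-zeroʳ a) ⟨
  suc (a + 0) * paths a 0    ∎
  where open ≡-Reasoning
paths-absorbˡ a (suc b) = begin
  suc a * (paths a (suc b) + paths (suc a) b)             ≡⟨ *-distribˡ-+ (suc a) (paths a (suc b)) _ ⟩
  suc a * paths a (suc b) + suc a * paths (suc a) b       ≡⟨ cong (suc a * paths a (suc b) +_) (paths-absorbˡ a b) ⟩
  suc a * paths a (suc b) + suc (a + b) * paths a b       ≡⟨ cong (suc a * paths a (suc b) +_) (paths-absorbʳ a b) ⟨
  suc a * paths a (suc b) + suc b * paths a (suc b)       ≡⟨ *-distribʳ-+ (paths a (suc b)) (suc a) (suc b) ⟨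
  suc (a + suc b) * paths a (suc b)                       ∎
  where open ≡-Reasoning

paths-absorbʳ zero b = begin
  suc b * paths 0 (suc b)    ≡⟨ cong (suc b *_) (paths-zeroˡ (suc b)) ⟩
  suc b * 1                  ≡⟨ cong (suc b *_) (paths-zeroˡ b) ⟨
  suc b * paths 0 b          ∎
  where open ≡-Reasoning
paths-absorbʳ (suc a) b = begin
  suc b * (paths a (suc b) + paths (suc a) b)             ≡⟨ *-distribˡ-+ (suc b) (paths a (suc b)) _ ⟩
  suc b * paths a (suc b) + suc b * paths (suc a) b       ≡⟨ cong (_+ suc b * paths (suc a) b) (paths-absorbʳ a b) ⟩
  suc (a + b) * paths a b + suc b * paths (suc a) b       ≡⟨ cong (_+ suc b * paths (suc a) b) (paths-absorbˡ a b) ⟨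
  suc a * paths (suc a) b + suc b * paths (suc a) b       ≡⟨ *-distribʳ-+ (paths (suc a) b) (suc a) (suc b) ⟨
  (suc a + suc b) * paths (suc a) b                       ≡⟨ cong (λ m → suc m * paths (suc a) b) (+-suc a b) ⟩
  suc (suc a + b) * paths (suc a) b                       ∎
  where open ≡-Reasoning

left-point : ∀ {b} x {y} v → left (walks b (point x y)) x v ≡ 0
left-point zero    v = refl
left-point {b} (suc x) {y} v = walks-point-outside {b} {suc x} {y} {x} {v} (inj₁ ≤-refl)

below-point : ∀ {b x} u y → below (walks b (point x y)) u y ≡ 0
below-point u zero    = refl
below-point {b} {x} u (suc y) = walks-point-outside {b} {x} {suc y} {u} {y} (inj₂ ≤-refl)

walks-translate : ∀ x y u v → walks nowhere (point x y) (u + x) (v + y) ≡ paths u v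
walks-translate x y u v = walks-unique u v recurrence u v ≤-refl ≤-refl
  where
  shifted : Grid
  shifted u v = walks nowhere (point x y) (u + x) (v + y)
  atOrigin : ∀ u v → point x y (u + x) (v + y) ≡ origin u v
  atOrigin u v = cong (if_then 1 else 0) (does-⇔ (mk⇔ (λ (p , q) → +-cancelʳ-≡ x u 0 p , +-cancelʳ-≡ y v 0 q)
                                                        (λ { (refl , refl) → refl , refl }))
                                                  (u + x ≟ x ×-dec v + y ≟ y) (u ≟ 0 ×-dec v ≟ 0))
  fromLeft : ∀ u v → left (walks nowhere (point x y)) (u + x) (v + y) ≡ left shifted u v
  fromLeft (suc u) v = refl
  fromLeft zero    v = left-point x (v + y)
  fromBelow : ∀ u v → below (walks nowhere (point x y)) (u + x) (v + y) ≡ below shifted u v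
  fromBelow u (suc v) = refl
  fromBelow u zero    = below-point (u + x) y
  recurrence : ∀ u′ v′ → u′ ≤ u → v′ ≤ v → shifted u′ v′ ≡ step nowhere origin shifted u′ v′
  recurrence u′ v′ _ _ = trans (walks-step (u′ + x) (v′ + y))
    (cong₂ _+_ (cong₂ _+_ (atOrigin u′ v′) (fromLeft u′ v′)) (fromBelow u′ v′))

-- Ballot paths and Catalan numbers

belowDiagonal : Region
belowDiagonal u v = does (v <? u)

ballot : Grid
ballot = walks belowDiagonal origin

ballot-below : ∀ {u v} → v < u → ballot u v ≡ 0
ballot-below {u} {v} v<u = walks-blocked {belowDiagonal} {origin} {u} {v} (dec-true (v <? u) v<u)

ballot-step : ∀ {u v} → u ≤ v → ballot u v ≡ origin u v + left ballot u v + below ballot u v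
ballot-step {u} {v} u≤v = walks-open {belowDiagonal} {origin} {u} {v} (dec-false (v <? u) (≤⇒≯ u≤v))

ballot-zeroˡ : ∀ v → ballot 0 v ≡ 1
ballot-zeroˡ zero    = refl
ballot-zeroˡ (suc v) = ballot-zeroˡ v

-- Reflection principle: the paths to (u, v) that cross the diagonal correspond to the
-- paths to (u - 1, v + 1).
ballot+reflected≡paths : ∀ u v → u ≤ v → ballot u v + left paths u (suc v) ≡ paths u v
ballot+reflected≡paths zero v _ = trans (+-identityʳ _) (trans (ballot-zeroˡ v) (sym (paths-zeroˡ v)))
ballot+reflected≡paths (suc u) (suc v) 1+u≤1+v@(s≤s u≤v) = begin
  ballot (suc u) (suc v) + paths u (suc (suc v))
    ≡⟨ cong₂ _+_ (ballot-step 1+u≤1+v) (paths-sucʳ u (suc v)) ⟩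
  (ballot u (suc v) + ballot (suc u) v) + (left paths u (suc (suc v)) + paths u (suc v))
    ≡⟨ interchange (ballot u (suc v)) (ballot (suc u) v) _ _ ⟩
  (ballot u (suc v) + left paths u (suc (suc v))) + (ballot (suc u) v + paths u (suc v))
    ≡⟨ cong₂ _+_ (ballot+reflected≡paths u (suc v) (m≤n⇒m≤1+n u≤v)) lastColumn ⟩
  paths u (suc v) + paths (suc u) v ∎
  where
  open ≡-Reasoning
  lastColumn : ballot (suc u) v + paths u (suc v) ≡ paths (suc u) v
  lastColumn with m≤n⇒m<n∨m≡n u≤v
  ... | inj₁ u<v  = ballot+reflected≡paths (suc u) v u<v
  ... | inj₂ refl = cong₂ _+_ (ballot-below {suc u} {u} ≤-refl) (paths-sym u (suc u))

ballot-diagonal : ∀ j → suc j * ballot j j ≡ paths j j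
ballot-diagonal zero    = refl
ballot-diagonal (suc u) = +-cancelʳ-≡ (c * E) (c * A) T (begin
  c * A + c * E       ≡⟨ *-distribˡ-+ c A E ⟨
  c * (A + E)         ≡⟨ cong (c *_) (ballot+reflected≡paths (suc u) (suc u) ≤-refl) ⟩
  c * T               ≡⟨ cong (T +_) reflected ⟨
  T + c * E           ∎)
  where
  open ≡-Reasoning
  c = suc (suc u)
  A = ballot (suc u) (suc u)
  E = paths u (suc (suc u))
  T = paths (suc u) (suc u)
  reflected : c * E ≡ suc u * T
  reflected = trans (paths-absorbʳ u (suc u)) (sym (paths-absorbˡ u (suc u)))

centralBinomial≡paths : ∀ k → (2 * k) C k ≡ paths k k
centralBinomial≡paths k = trans (cong (λ m → (k + m) C k) (+-identityʳ k)) (sym (paths≡binomial k k))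

catalan≡ballot : ∀ j → catalan j ≡ ballot j j
catalan≡ballot j = begin
  ((2 * j) C j) / suc j        ≡⟨ cong (_/ suc j) (centralBinomial≡paths j) ⟩
  paths j j / suc j            ≡⟨ cong (_/ suc j) (trans (*-comm (ballot j j) (suc j)) (ballot-diagonal j)) ⟨
  (ballot j j * suc j) / suc j ≡⟨ m*n/n≡m (ballot j j) (suc j) ⟩
  ballot j j                   ∎
  where open ≡-Reasoning

-- The first step below the diagonal

wall : ℕ → Region
wall n u v = does (u ≟ suc v ×-dec u ≤? n)

exits : ℕ → ℕ → Grid
exits n r u v = sumBelow r (λ i → ballot (n + i) (n + i) * point (suc (n + i)) (n + i) u v)

module _ (n r : ℕ) where

  private
    term-elsewhere : ∀ {i u v} → ¬ (u ≡ suc (n + i) × v ≡ n + i) →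
                     ballot (n + i) (n + i) * point (suc (n + i)) (n + i) u v ≡ 0
    term-elsewhere {i} {u} {v} ne =
      trans (cong (ballot (n + i) (n + i) *_) (point-elsewhere {u = u} {v} ne)) (*-zeroʳ (ballot (n + i) (n + i)))

  exits-off : ∀ {u v} → u ≢ suc v → exits n r u v ≡ 0
  exits-off {u} {v} u≢1+v = sumBelow-zero r (λ _ → term-elsewhere {u = u} {v} λ { (refl , refl) → u≢1+v refl })

  exits-low : ∀ {u v} → v < n → exits n r u v ≡ 0
  exits-low {u} {v} v<n =
    sumBelow-zero r (λ {i} _ → term-elsewhere {i} {u} {v} λ { (_ , refl) → <⇒≱ v<n (m≤m+n n i) })

  exits-on : ∀ {v} → n ≤ v → v < n + r → exits n r (suc v) v ≡ ballot v v
  exits-on {v} n≤v v<n+r with v ∸ n | m+[n∸m]≡n n≤v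
  ... | i | refl = begin
    exits n r (suc (n + i)) (n + i)
      ≡⟨ sumBelow-single (+-cancelˡ-< n i r v<n+r) others ⟩
    ballot (n + i) (n + i) * point (suc (n + i)) (n + i) (suc (n + i)) (n + i)
      ≡⟨ cong (ballot (n + i) (n + i) *_) (point-at (suc (n + i)) (n + i)) ⟩
    ballot (n + i) (n + i) * 1
      ≡⟨ *-identityʳ _ ⟩
    ballot (n + i) (n + i) ∎
    where
    open ≡-Reasoning
    others : ∀ {j} → j ≢ i → ballot (n + j) (n + j) * point (suc (n + j)) (n + j) (suc (n + i)) (n + i) ≡ 0
    others {j} j≢i =
      term-elsewhere {j} {suc (n + i)} {n + i} λ (_ , n+i≡n+j) → j≢i (sym (+-cancelˡ-≡ n i _ n+i≡n+j))

below-ballot : ∀ {u v} → v < u → below ballot u v ≡ 0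
below-ballot {v = zero}  _   = refl
below-ballot {v = suc v} v<u = ballot-below (<-trans (n<1+n v) v<u)

-- Off the wall, ballot numbers obey the recurrence of paths avoiding the wall, up to the
-- sources at (j + 1, j): the paths that cross the diagonal there for the first time.
ballot-recurrence : ∀ n r {u v} → ¬ (u ≡ suc v × u ≤ n) → u ≤ n + r →
                    ballot u v + exits n r u v ≡ origin u v + left ballot u v + below ballot u v
ballot-recurrence n r {u} {v} notWall u≤n+r with u ≤? v
... | yes u≤v =
  trans (cong₂ _+_ (ballot-step u≤v) (exits-off n r λ u≡1+v → <-irrefl refl (subst (_≤ v) u≡1+v u≤v)))
        (+-identityʳ _)
ballot-recurrence n r {zero}  _ _ | no 0≰v = contradiction z≤n 0≰v
ballot-recurrence n r {suc u} {v} notWall u≤n+r | no u≰v with m≤n⇒m<n∨m≡n (≤-pred (≰⇒> u≰v))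
... | inj₁ v<u  = begin
  ballot (suc u) v + exits n r (suc u) v
    ≡⟨ cong₂ _+_ (ballot-below (<-trans v<u (n<1+n u))) (exits-off n r λ e → <-irrefl (sym (suc-injective e)) v<u) ⟩
  0
    ≡⟨ cong₂ _+_ (ballot-below v<u) (below-ballot (<-trans v<u (n<1+n u))) ⟨
  0 + ballot u v + below ballot (suc u) v ∎
  where open ≡-Reasoning
... | inj₂ refl = begin
  ballot (suc v) v + exits n r (suc v) v   ≡⟨ cong₂ _+_ (ballot-below (n<1+n v)) (exits-on n r n≤v u≤n+r) ⟩
  ballot v v                               ≡⟨ +-identityʳ (ballot v v) ⟨
  ballot v v + 0                           ≡⟨ cong (ballot v v +_) (below-ballot (n<1+n v)) ⟨
  0 + ballot v v + below ballot (suc v) v  ∎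
  where
  open ≡-Reasoning
  n≤v : n ≤ v
  n≤v = ≤-pred (≰⇒> λ 1+v≤n → notWall (refl , 1+v≤n))

crossings-low : ∀ n r {u v} → v < n → walks nowhere (exits n r) u v ≡ 0
crossings-low n r {u} {v} v<n = walks-vanish u v λ x _ _ y≤v → exits-low n r {x} (≤-<-trans y≤v v<n)

walks-wall≡ballot+crossings : ∀ n r {u v} → u ≤ n + r →
                              walks (wall n) origin u v ≡ ballot u v + walks nowhere (exits n r) u v
walks-wall≡ballot+crossings n r {u} {v} u≤n+r = sym (walks-unique (n + r) v recurrence u v u≤n+r ≤-refl)
  where
  crossings split : Grid
  crossings = walks nowhere (exits n r)
  split x y = ballot x y + crossings x y
  regroup : ∀ a b c d → a + (b + c + d) ≡ a + b + c + d
  regroup = solve-∀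
  shuffle : ∀ a b c d e → a + b + c + d + e ≡ a + (b + d) + (c + e)
  shuffle = solve-∀
  recurrence : ∀ x y → x ≤ n + r → y ≤ v → split x y ≡ step (wall n) origin split x y
  recurrence x y x≤n+r _ with x ≟ suc y ×-dec x ≤? n
  ... | yes (refl , 1+y≤n) =
    trans (cong₂ _+_ (ballot-below {suc y} {y} ≤-refl) (crossings-low n r {suc y} 1+y≤n))
          (sym (step-blocked {wall n} {origin} {split} {suc y} {y}
                             (dec-true (suc y ≟ suc y ×-dec suc y ≤? n) (refl , 1+y≤n))))
  ... | no notWall = begin
    ballot x y + crossings x y
      ≡⟨ cong (ballot x y +_) (walks-step x y) ⟩
    ballot x y + (exits n r x y + left crossings x y + below crossings x y)
      ≡⟨ regroup (ballot x y) _ _ _ ⟩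
    ballot x y + exits n r x y + left crossings x y + below crossings x y
      ≡⟨ cong (λ z → z + left crossings x y + below crossings x y) (ballot-recurrence n r notWall x≤n+r) ⟩
    origin x y + left ballot x y + below ballot x y + left crossings x y + below crossings x y
      ≡⟨ shuffle (origin x y) _ _ _ _ ⟩
    origin x y + (left ballot x y + left crossings x y) + (below ballot x y + below crossings x y)
      ≡⟨ cong₂ (λ l d → origin x y + l + d) (left-+ {f = ballot} {g = crossings} x y)
                                             (below-+ {f = ballot} {g = crossings} x y) ⟨
    origin x y + left split x y + below split x y
      ≡⟨ step-open {wall n} {origin} {split} {x} {y} (dec-false (x ≟ suc y ×-dec x ≤? n) notWall) ⟨
    step (wall n) origin split x y ∎
    where open ≡-Reasoning

count : (Path → Bool) → List Path → ℕ
count f πs = length (filter (λ π → f π ≟ᵇ true) πs)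

module _ {f : Path → Bool} where

  private
    accepts? = λ π → f π ≟ᵇ true

  count-++ : ∀ πs ρs → count f (πs ++ ρs) ≡ count f πs + count f ρs
  count-++ πs ρs = trans (cong length (filter-++ accepts? πs ρs)) (length-++ (filter accepts? πs))

  count-map : ∀ (g : Path → Path) πs → count f (map g πs) ≡ count (λ π → f (g π)) πs
  count-map g []       = refl
  count-map g (π ∷ πs) with f (g π) ≟ᵇ true
  ... | yes _ = cong suc (count-map g πs)
  ... | no  _ = count-map g πs

  count-cong : ∀ {g} → (∀ π → f π ≡ g π) → ∀ πs → count f πs ≡ count g πs
  count-cong f≗g πs = cong length (filter-≐ accepts? _ (to , from) πs)
    where
    to   = λ {π} → trans (sym (f≗g π))
    from = λ {π} → trans (f≗g π)

  count-none : (∀ π → f π ≡ false) → ∀ πs → count f πs ≡ 0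
  count-none rejects πs = cong length (filter-none accepts? (universal rejected πs))
    where
    rejected : ∀ π → ¬ f π ≡ true
    rejected π accepted = case trans (sym (rejects π)) accepted of λ ()

  count-singleton : ∀ {π} → f π ≡ true → count f (π ∷ []) ≡ 1
  count-singleton accepted = cong length (filter-accept accepts? accepted)

count-allPaths : ∀ f L → count f (allPaths (suc L)) ≡
                 count (λ π → f (true ∷ π)) (allPaths L) + count (λ π → f (false ∷ π)) (allPaths L)
count-allPaths f L = trans (count-++ (map (true ∷_) (allPaths L)) _)
                           (cong₂ _+_ (count-map (true ∷_) (allPaths L)) (count-map (false ∷_) (allPaths L)))

endFrom-≥ : ∀ x y π → x ≤ proj₁ (endFrom (x , y) π) × y ≤ proj₂ (endFrom (x , y) π)
endFrom-≥ x y []          = ≤-refl , ≤-refl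
endFrom-≥ x y (true ∷ π)  with endFrom-≥ (suc x) y π
... | x<x′ , y≤y′ = <⇒≤ x<x′ , y≤y′
endFrom-≥ x y (false ∷ π) with endFrom-≥ x (suc y) π
... | x≤x′ , y<y′ = x≤x′ , <⇒≤ y<y′

module Reversal (n r : ℕ) (1≤r : 1 ≤ r) where

  a b : ℕ
  a = n + r
  b = n + r ∸ 1

  a≡1+b : a ≡ suc b
  a≡1+b = sym (m+[n∸m]≡n (≤-trans 1≤r (m≤n+m r n)))

  arrives : ℕ × ℕ → Bool
  arrives (x , y) = does (x ≟ a ×-dec y ≟ b)

  admissibleFrom : ℕ × ℕ → Path → Bool
  admissibleFrom p π = arrives (endFrom p π) ∧ not (touchesFrom r p π)

  admissible : ℕ × ℕ → ℕ → ℕ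
  admissible p L = count (admissibleFrom p) (allPaths L)

  admissible-step : ∀ p L → admissible p (suc L) ≡
                    (if forbidden r p then 0 else admissible (move true p) L + admissible (move false p) L)
  admissible-step p L with forbidden r p in startForbidden
  ... | true  = trans (count-allPaths (admissibleFrom p) L)
                      (cong₂ _+_ (count-none (rejected true) (allPaths L)) (count-none (rejected false) (allPaths L)))
    where
    rejected : ∀ s π → admissibleFrom p (s ∷ π) ≡ false
    rejected s π = trans (cong (λ c → arrives (endFrom (move s p) π) ∧ not (c ∨ touchesFrom r (move s p) π))
                               startForbidden)
                         (∧-zeroʳ _)
  ... | false = trans (count-allPaths (admissibleFrom p) L)
                      (cong₂ _+_ (count-cong (continued true) (allPaths L)) (count-cong (continued false) (allPaths L)))
    where
    continued : ∀ s π → admissibleFrom p (s ∷ π) ≡ admissibleFrom (move s p) π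
    continued s π =
      cong (λ c → arrives (endFrom (move s p) π) ∧ not (c ∨ touchesFrom r (move s p) π)) startForbidden

  admissible-beyond : ∀ {x y} L → a < x ⊎ b < y → admissible (x , y) L ≡ 0
  admissible-beyond {x} {y} L beyond = count-none missesTarget (allPaths L)
    where
    missesTarget : ∀ π → admissibleFrom (x , y) π ≡ false
    missesTarget π = cong (_∧ not (touchesFrom r (x , y) π)) (dec-false (x′ ≟ a ×-dec y′ ≟ b) missed)
      where
      x′ = proj₁ (endFrom (x , y) π)
      y′ = proj₂ (endFrom (x , y) π)
      unreachable : x′ ≡ a → y′ ≡ b → ¬ (a < x ⊎ b < y)
      unreachable x′≡a _ (inj₁ a<x) = <⇒≱ a<x (subst (x ≤_) x′≡a (proj₁ (endFrom-≥ x y π)))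
      unreachable _ y′≡b (inj₂ b<y) = <⇒≱ b<y (subst (y ≤_) y′≡b (proj₂ (endFrom-≥ x y π)))
      missed : ¬ (x′ ≡ a × y′ ≡ b)
      missed (x′≡a , y′≡b) = unreachable x′≡a y′≡b beyond

  forbidden-reversed : ∀ {x y u v} → x + u ≡ a → y + v ≡ b → forbidden r (x , y) ≡ wall n u v
  forbidden-reversed {x} {y} {u} {v} x+u≡a y+v≡b =
    does-⇔ (mk⇔ (λ (x≡y , r≤x) → diagonal⇒ x≡y , threshold⇒ r≤x)
                (λ (u≡1+v , u≤n) → diagonal⇐ u≡1+v , threshold⇐ u≤n))
           (x ≟ y ×-dec r ≤? x) (u ≟ suc v ×-dec u ≤? n)
    where
    x+u≡y+1+v : x + u ≡ y + suc v
    x+u≡y+1+v = trans x+u≡a (trans a≡1+b (trans (cong suc (sym y+v≡b)) (sym (+-suc y v))))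
    diagonal⇒ : x ≡ y → u ≡ suc v
    diagonal⇒ refl = +-cancelˡ-≡ x u (suc v) x+u≡y+1+v
    diagonal⇐ : u ≡ suc v → x ≡ y
    diagonal⇐ refl = +-cancelʳ-≡ u x y x+u≡y+1+v
    threshold⇒ : r ≤ x → u ≤ n
    threshold⇒ r≤x = +-cancelʳ-≤ r u n (begin
      u + r  ≡⟨ +-comm u r ⟩
      r + u  ≤⟨ +-monoˡ-≤ u r≤x ⟩
      x + u  ≡⟨ x+u≡a ⟩
      n + r  ∎)
      where open ≤-Reasoning
    threshold⇐ : u ≤ n → r ≤ x
    threshold⇐ u≤n = +-cancelʳ-≤ u r x (begin
      r + u  ≤⟨ +-monoʳ-≤ r u≤n ⟩
      r + n  ≡⟨ +-comm r n ⟩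
      n + r  ≡⟨ x+u≡a ⟨
      x + u  ∎)
      where open ≤-Reasoning

  admissible≡walks : ∀ u v {x y} → x + u ≡ a → y + v ≡ b →
                     admissible (x , y) (u + v) ≡ walks (wall n) origin u v
  admissible≡walks zero zero {x} {y} x+0≡a y+0≡b =
    count-singleton {admissibleFrom (x , y)} {[]}
      (cong₂ _∧_ atTarget (cong not (forbidden-reversed {x} {y} {0} {0} x+0≡a y+0≡b)))
    where
    atTarget : arrives (x , y) ≡ true
    atTarget = dec-true (x ≟ a ×-dec y ≟ b) (trans (sym (+-identityʳ x)) x+0≡a , trans (sym (+-identityʳ y)) y+0≡b)
  admissible≡walks (suc u) zero {x} {y} x+1+u≡a y+0≡b = trans (admissible-step (x , y) (u + 0))
    (cong₂ (λ c z → if c then 0 else z) (forbidden-reversed x+1+u≡a y+0≡b)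
      (cong₂ _+_ (admissible≡walks u 0 (trans (sym (+-suc x u)) x+1+u≡a) y+0≡b)
                 (admissible-beyond (u + 0) (inj₂ (≤-reflexive (cong suc (trans (sym y+0≡b) (+-identityʳ y))))))))
  admissible≡walks zero (suc v) {x} {y} x+0≡a y+1+v≡b = trans (admissible-step (x , y) v)
    (cong₂ (λ c z → if c then 0 else z) (forbidden-reversed x+0≡a y+1+v≡b)
      (cong₂ _+_ (admissible-beyond v (inj₁ (≤-reflexive (cong suc (trans (sym x+0≡a) (+-identityʳ x))))))
                 (admissible≡walks 0 v x+0≡a (trans (sym (+-suc y v)) y+1+v≡b))))
  admissible≡walks (suc u) (suc v) {x} {y} x+1+u≡a y+1+v≡b = trans (admissible-step (x , y) (u + suc v))
    (cong₂ (λ c z → if c then 0 else z) (forbidden-reversed x+1+u≡a y+1+v≡b)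
      (cong₂ _+_ (admissible≡walks u (suc v) (trans (sym (+-suc x u)) x+1+u≡a) y+1+v≡b)
                 (trans (cong (admissible (x , suc y)) (+-suc u v))
                        (admissible≡walks (suc u) v x+1+u≡a (trans (sym (+-suc y v)) y+1+v≡b)))))

  endsAt≡arrives : ∀ π → endsAt a b π ≡ arrives (endFrom (0 , 0) π)
  endsAt≡arrives π with endFrom (0 , 0) π
  ... | _ , _ = refl

  P≡walks : P n r ≡ walks (wall n) origin a b
  P≡walks = trans (count-cong (λ π → cong (_∧ not (touchesFrom r (0 , 0) π)) (endsAt≡arrives π))
                              (allPaths (a + b)))
                  (admissible≡walks a b refl refl)

viaExit : ℕ → Grid
viaExit j u v = ballot j j * walks nowhere (point (suc j) j) u v

crossings≡viaExits : ∀ n r u v → walks nowhere (exits n r) u v ≡ sumBelow r (λ i → viaExit (n + i) u v)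
crossings≡viaExits n r = walks-sum r (λ i → ballot (n + i) (n + i)) (λ i → point (suc (n + i)) (n + i))

viaExit-count : ∀ n {r k} → k < r →
                viaExit (n + (r ∸ suc k)) (n + r) (n + r ∸ 1) ≡ ((2 * k) C k) * catalan (n + r ∸ k ∸ 1)
viaExit-count n {r} {k} k<r with r ∸ suc k | m+[n∸m]≡n k<r
... | d | refl = begin
  ballot j j * walks nowhere (point (suc j) j) (n + suc (k + d)) (n + suc (k + d) ∸ 1)
    ≡⟨ cong (ballot j j *_) (trans (cong₂ (walks nowhere (point (suc j) j)) (trans east (sym (+-suc k j)))
                                                                             (cong (_∸ 1) east))
                                   (walks-translate (suc j) j k k)) ⟩
  ballot j j * paths k k
    ≡⟨ *-comm (ballot j j) (paths k k) ⟩
  paths k k * ballot j j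
    ≡⟨ cong₂ _*_ (centralBinomial≡paths k) (trans (cong catalan diagonal) (catalan≡ballot j)) ⟨
  ((2 * k) C k) * catalan (n + suc (k + d) ∸ k ∸ 1) ∎
  where
  open ≡-Reasoning
  j = n + d
  east : n + suc (k + d) ≡ suc (k + j)
  east = trans (+-suc n (k + d)) (cong suc (x∙yz≈y∙xz n k d))
  diagonal : n + suc (k + d) ∸ k ∸ 1 ≡ j
  diagonal = cong (_∸ 1) (trans (cong (_∸ k) (trans east (sym (+-suc k j)))) (m+n∸m≡n k (suc j)))

proposition1 : (n r : ℕ) → 1 ≤ r →
    P n r ≡ sumBelow r (λ k → ((2 * k) C k) * catalan (n + r ∸ k ∸ 1))
proposition1 n r 1≤r = begin
  P n r                                             ≡⟨ P≡walks ⟩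
  walks (wall n) origin a b                         ≡⟨ walks-wall≡ballot+crossings n r ≤-refl ⟩
  ballot a b + crossings                            ≡⟨ cong (_+ crossings) (ballot-below (≤-reflexive (sym a≡1+b))) ⟩
  crossings                                         ≡⟨ crossings≡viaExits n r a b ⟩
  sumBelow r (λ i → viaExit (n + i) a b)            ≡⟨ sumBelow-reverse r _ ⟩
  sumBelow r (λ k → viaExit (n + (r ∸ suc k)) a b)  ≡⟨ sumBelow-cong r (viaExit-count n) ⟩
  sumBelow r (λ k → ((2 * k) C k) * catalan (n + r ∸ k ∸ 1)) ∎
  where
  open Reversal n r 1≤r
  open ≡-Reasoning
  crossings = walks nowhere (exits n r) a b
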